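{- Let $P$ be a monic prime in $A = \mathbb{F}_q[T]$, let $\alpha \in \mathbb{F}_q^{\times}$, and set $M_P := \alpha C_P(1)$. Let $Q$ be a monic prime in $A$ dividing $M_P$, and let $\wp_Q$ be the Carlitz annihilator of $Q$. Then $\wp_Q = P$.
   Context: $q$ is a power of a prime, $A = \mathbb{F}_q[T]$. The Carlitz module is the unique $\mathbb{F}_q$-algebra homomorphism $a \mapsto C_a$ from $A$ to the ring of $\mathbb{F}_q$-linear polynomials in $A[x]$ (composition as multiplication) with $C_T(x) = Tx + x^q$; $C_a(1)$ is the value of $C_a(x)$ at $x=1$. For a monic prime $Q$ of positive degree, the Carlitz annihilator of $Q$ is the unique monic polynomial $\wp_Q \in A$ of positive degree such that $C_{\wp_Q}(1) \equiv 0 \pmod Q$ and, for every nonzero $a \in A$, $\wp_Q \mid a$ if and only if $C_a(1) \equiv 0 \pmod Q$. -}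

module Defs where

open import Level using (Level; _⊔_)
open import Data.Nat using (ℕ; zero; suc; _<_; _≤_)
open import Data.Fin using (Fin)
open import Data.List using (List; []; _∷_)
open import Data.Product using (Σ; ∃; ∃-syntax; _×_; _,_)
open import Data.Sum using (_⊎_)
open import Relation.Nullary using (¬_)
open import Algebra.Bundles using (CommutativeRing)
open import Relation.Binary.PropositionalEquality using (_≡_)

record FiniteField (c ℓ : Level) : Set (Level.suc (c ⊔ ℓ)) where
  field
    commRing : CommutativeRing c ℓ
  open CommutativeRing commRing public
  field
    0≉1      : ¬ (0# ≈ 1#)
    inverse  : ∀ x → ¬ (x ≈ 0#) → ∃[ y ] (x * y ≈ 1#)
    q        : ℕ
    enum     : Fin q → Carrier
    enum-inj : ∀ i j → enum i ≈ enum j → i ≡ j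
    enum-sur : ∀ x → ∃[ i ] (enum i ≈ x)

-- Polynomials A = F_q[T] over a finite field, as coefficient lists
-- (constant term first); equality is coefficientwise (so trailing zeros
-- are irrelevant).
module Poly {c ℓ : Level} (F : FiniteField c ℓ) where
  open FiniteField F public

  Pol : Set c
  Pol = List Carrier

  coeff : Pol → ℕ → Carrier
  coeff []       _       = 0#
  coeff (a ∷ _)  zero    = a
  coeff (_ ∷ as) (suc n) = coeff as n

  infix 4 _≈ₚ_
  _≈ₚ_ : Pol → Pol → Set ℓ
  f ≈ₚ g = ∀ n → coeff f n ≈ coeff g n

  infixl 6 _+ₚ_
  _+ₚ_ : Pol → Pol → Pol
  []       +ₚ g        = g
  (a ∷ f)  +ₚ []       = a ∷ f
  (a ∷ f)  +ₚ (b ∷ g)  = (a + b) ∷ (f +ₚ g)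

  infixl 7 _·ₚ_
  _·ₚ_ : Carrier → Pol → Pol
  a ·ₚ []      = []
  a ·ₚ (b ∷ f) = (a * b) ∷ (a ·ₚ f)

  infixl 7 _*ₚ_
  _*ₚ_ : Pol → Pol → Pol
  []      *ₚ g = []
  (a ∷ f) *ₚ g = (a ·ₚ g) +ₚ (0# ∷ (f *ₚ g))

  oneₚ : Pol
  oneₚ = 1# ∷ []

  Tₚ : Pol
  Tₚ = 0# ∷ 1# ∷ []

  _^ₚ_ : Pol → ℕ → Pol
  f ^ₚ zero  = oneₚ
  f ^ₚ suc n = f *ₚ (f ^ₚ n)

  IsZero : Pol → Set ℓ
  IsZero f = ∀ n → coeff f n ≈ 0#

  infix 4 _∣ₚ_
  _∣ₚ_ : Pol → Pol → Set (c ⊔ ℓ)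
  f ∣ₚ g = ∃[ h ] (g ≈ₚ h *ₚ f)

  PositiveDegree : Pol → Set ℓ
  PositiveDegree f = ∃[ n ] (1 ≤ n × ¬ (coeff f n ≈ 0#))

  Monic : Pol → Set ℓ
  Monic f = ∃[ d ] (coeff f d ≈ 1# × (∀ n → d < n → coeff f n ≈ 0#))

  -- f is a monic prime of A: monic, of positive degree (hence a nonzero
  -- non-unit), and a prime element
  MonicPrime : Pol → Set (c ⊔ ℓ)
  MonicPrime f = Monic f × PositiveDegree f
               × (∀ g h → f ∣ₚ (g *ₚ h) → (f ∣ₚ g) ⊎ (f ∣ₚ h))

  -- Carlitz module evaluated at 1.
  -- carlitzT i = C_{T^i}(1) = (C_T ∘ ... ∘ C_T)(1), with C_T(x) = T x + x^q.
  carlitzT : ℕ → Pol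
  carlitzT zero    = oneₚ
  carlitzT (suc i) = (Tₚ *ₚ carlitzT i) +ₚ (carlitzT i ^ₚ q)

  -- C_a(1) = Σ_i a_i C_{T^i}(1)  (a ↦ C_a is F_q-linear)
  carlitzFrom : Pol → ℕ → Pol
  carlitzFrom []      i = []
  carlitzFrom (a ∷ f) i = (a ·ₚ carlitzT i) +ₚ carlitzFrom f (suc i)

  C[_]1 : Pol → Pol
  C[ a ]1 = carlitzFrom a 0

  IsCarlitzAnnihilator : Pol → Pol → Set (c ⊔ ℓ)
  IsCarlitzAnnihilator Q ℘ =
    Monic ℘ × PositiveDegree ℘ × (Q ∣ₚ C[ ℘ ]1)
    × (∀ a → ¬ IsZero a → ((℘ ∣ₚ a → Q ∣ₚ C[ a ]1) × (Q ∣ₚ C[ a ]1 → ℘ ∣ₚ a)))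

-- Since α is a unit, Q ∣ C_P(1), so the defining property of the Carlitz
-- annihilator gives ℘ ∣ P, say P = h ℘. Comparing leading coefficients, h is
-- monic with deg h + deg ℘ = deg P. As P is prime it divides h or ℘; it cannot
-- divide h because deg h < deg P (℘ has positive degree), so it divides ℘,
-- forcing deg h = 0, i.e. h = 1 and ℘ = P.
module Submission where

open import Defs
open import Level using (Level)
open import Relation.Nullary using (¬_; Dec; yes; no)
open import Data.Product using (_×_; _,_; ∃; ∃-syntax; proj₁; proj₂)
open import Data.Sum using (_⊎_; inj₁; inj₂)
open import Data.Empty using (⊥-elim)
open import Data.Nat as ℕ using (ℕ; zero; suc; z≤n; s≤s)
import Data.Nat.Properties as ℕₚ
open import Data.List using ([]; _∷_)
import Data.Fin as Fin
import Relation.Binary.PropositionalEquality as ≡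

module PolynomialDegree {c ℓ : Level} (F : FiniteField c ℓ) where
  open Poly F hiding (zero)
  open import Relation.Binary.Reasoning.Setoid setoid

  _≟0 : ∀ x → Dec (x ≈ 0#)
  x ≟0 with enum-sur x | enum-sur 0#
  ... | i , eᵢ | j , eⱼ with i Fin.≟ j
  ...   | yes ≡.refl = yes (trans (sym eᵢ) eⱼ)
  ...   | no i≢j     = no λ x≈0 → i≢j (enum-inj i j (trans eᵢ (trans x≈0 (sym eⱼ))))

  1≉0 : ¬ (1# ≈ 0#)
  1≉0 1≈0 = 0≉1 (sym 1≈0)

  DegreeAtMost : Pol → ℕ → Set ℓ
  DegreeAtMost f d = ∀ n → d ℕ.< n → coeff f n ≈ 0#

  HasDegree : Pol → ℕ → Set ℓ
  HasDegree f d = ¬ (coeff f d ≈ 0#) × DegreeAtMost f d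

  MonicOfDegree : Pol → ℕ → Set ℓ
  MonicOfDegree f d = coeff f d ≈ 1# × DegreeAtMost f d

  monic⇒hasDegree : ∀ f {d} → MonicOfDegree f d → HasDegree f d
  monic⇒hasDegree f (lead , bound) = (λ lead≈0 → 1≉0 (trans (sym lead) lead≈0)) , bound

  coeff-+ₚ : ∀ f g n → coeff (f +ₚ g) n ≈ coeff f n + coeff g n
  coeff-+ₚ []      g       n       = sym (+-identityˡ _)
  coeff-+ₚ (a ∷ f) []      zero    = sym (+-identityʳ _)
  coeff-+ₚ (a ∷ f) []      (suc n) = sym (+-identityʳ _)
  coeff-+ₚ (a ∷ f) (b ∷ g) zero    = refl
  coeff-+ₚ (a ∷ f) (b ∷ g) (suc n) = coeff-+ₚ f g n

  coeff-·ₚ : ∀ a f n → coeff (a ·ₚ f) n ≈ a * coeff f n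
  coeff-·ₚ a []      n       = sym (zeroʳ a)
  coeff-·ₚ a (b ∷ f) zero    = refl
  coeff-·ₚ a (b ∷ f) (suc n) = coeff-·ₚ a f n

  coeff-∷*ₚ-zero : ∀ a f g → coeff ((a ∷ f) *ₚ g) zero ≈ a * coeff g zero
  coeff-∷*ₚ-zero a f g = begin
    coeff ((a ·ₚ g) +ₚ (0# ∷ (f *ₚ g))) zero ≈⟨ coeff-+ₚ (a ·ₚ g) (0# ∷ (f *ₚ g)) zero ⟩
    coeff (a ·ₚ g) zero + 0#                 ≈⟨ +-identityʳ _ ⟩
    coeff (a ·ₚ g) zero                      ≈⟨ coeff-·ₚ a g zero ⟩
    a * coeff g zero                         ∎

  coeff-∷*ₚ-suc : ∀ a f g n →
    coeff ((a ∷ f) *ₚ g) (suc n) ≈ a * coeff g (suc n) + coeff (f *ₚ g) n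
  coeff-∷*ₚ-suc a f g n = trans (coeff-+ₚ (a ·ₚ g) (0# ∷ (f *ₚ g)) (suc n))
                                (+-congʳ (coeff-·ₚ a g (suc n)))

  ·ₚ-*ₚ-assoc : ∀ a f g n → coeff ((a ·ₚ f) *ₚ g) n ≈ a * coeff (f *ₚ g) n
  ·ₚ-*ₚ-assoc a []      g n       = sym (zeroʳ a)
  ·ₚ-*ₚ-assoc a (b ∷ f) g zero    = begin
    coeff ((a * b ∷ a ·ₚ f) *ₚ g) zero ≈⟨ coeff-∷*ₚ-zero (a * b) (a ·ₚ f) g ⟩
    a * b * coeff g zero               ≈⟨ *-assoc a b _ ⟩
    a * (b * coeff g zero)             ≈⟨ *-congˡ (sym (coeff-∷*ₚ-zero b f g)) ⟩
    a * coeff ((b ∷ f) *ₚ g) zero      ∎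
  ·ₚ-*ₚ-assoc a (b ∷ f) g (suc n) = begin
    coeff ((a * b ∷ a ·ₚ f) *ₚ g) (suc n)                 ≈⟨ coeff-∷*ₚ-suc (a * b) (a ·ₚ f) g n ⟩
    a * b * coeff g (suc n) + coeff ((a ·ₚ f) *ₚ g) n     ≈⟨ +-cong (*-assoc a b _) (·ₚ-*ₚ-assoc a f g n) ⟩
    a * (b * coeff g (suc n)) + a * coeff (f *ₚ g) n      ≈⟨ sym (distribˡ a _ _) ⟩
    a * (b * coeff g (suc n) + coeff (f *ₚ g) n)          ≈⟨ *-congˡ (sym (coeff-∷*ₚ-suc b f g n)) ⟩
    a * coeff ((b ∷ f) *ₚ g) (suc n)                      ∎

  IsZero-*ₚ : ∀ f g → IsZero f → IsZero (f *ₚ g)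
  IsZero-*ₚ []      g f≈0 n       = refl
  IsZero-*ₚ (a ∷ f) g f≈0 zero    =
    trans (coeff-∷*ₚ-zero a f g) (trans (*-congʳ (f≈0 zero)) (zeroˡ _))
  IsZero-*ₚ (a ∷ f) g f≈0 (suc n) = trans (coeff-∷*ₚ-suc a f g n)
    (trans (+-cong (trans (*-congʳ (f≈0 zero)) (zeroˡ _)) (IsZero-*ₚ f g (λ k → f≈0 (suc k)) n))
           (+-identityʳ _))

  coeff-*ₚ-constant : ∀ f g → DegreeAtMost f 0 → ∀ n → coeff (f *ₚ g) n ≈ coeff f 0 * coeff g n
  coeff-*ₚ-constant []      g f≤0 n       = sym (zeroˡ _)
  coeff-*ₚ-constant (a ∷ f) g f≤0 zero    = coeff-∷*ₚ-zero a f g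
  coeff-*ₚ-constant (a ∷ f) g f≤0 (suc n) = trans (coeff-∷*ₚ-suc a f g n)
    (trans (+-congˡ (IsZero-*ₚ f g (λ k → f≤0 (suc k) (s≤s z≤n)) n)) (+-identityʳ _))

  tail-degreeAtMost : ∀ {a f m} → DegreeAtMost (a ∷ f) (suc m) → DegreeAtMost f m
  tail-degreeAtMost f≤1+m n m<n = f≤1+m (suc n) (s≤s m<n)

  *ₚ-degreeAtMost : ∀ f g m k → DegreeAtMost f m → DegreeAtMost g k → DegreeAtMost (f *ₚ g) (m ℕ.+ k)
  *ₚ-degreeAtMost []      g m       k f≤m g≤k n _ = refl
  *ₚ-degreeAtMost (a ∷ f) g zero    k f≤0 g≤k n k<n =
    trans (coeff-*ₚ-constant (a ∷ f) g f≤0 n) (trans (*-congˡ (g≤k n k<n)) (zeroʳ _))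
  *ₚ-degreeAtMost (a ∷ f) g (suc m) k f≤m g≤k (suc n) (s≤s m+k<n) = trans (coeff-∷*ₚ-suc a f g n)
    (trans (+-cong (trans (*-congˡ (g≤k (suc n) k<1+n)) (zeroʳ _))
                   (*ₚ-degreeAtMost f g m k (tail-degreeAtMost f≤m) g≤k n m+k<n))
           (+-identityʳ _))
    where
    k<1+n : k ℕ.< suc n
    k<1+n = s≤s (ℕₚ.≤-trans (ℕₚ.m≤n+m k m) (ℕₚ.<⇒≤ m+k<n))

  coeff-*ₚ-top : ∀ f g m k → DegreeAtMost f m → DegreeAtMost g k →
    coeff (f *ₚ g) (m ℕ.+ k) ≈ coeff f m * coeff g k
  coeff-*ₚ-top []      g m       k f≤m g≤k = sym (zeroˡ _)
  coeff-*ₚ-top (a ∷ f) g zero    k f≤0 g≤k = coeff-*ₚ-constant (a ∷ f) g f≤0 k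
  coeff-*ₚ-top (a ∷ f) g (suc m) k f≤m g≤k = begin
    coeff ((a ∷ f) *ₚ g) (suc (m ℕ.+ k))               ≈⟨ coeff-∷*ₚ-suc a f g (m ℕ.+ k) ⟩
    a * coeff g (suc (m ℕ.+ k)) + coeff (f *ₚ g) (m ℕ.+ k)
      ≈⟨ +-cong (trans (*-congˡ (g≤k _ (s≤s (ℕₚ.m≤n+m k m)))) (zeroʳ _))
                (coeff-*ₚ-top f g m k (tail-degreeAtMost f≤m) g≤k) ⟩
    0# + coeff f m * coeff g k                         ≈⟨ +-identityˡ _ ⟩
    coeff f m * coeff g k                              ∎

  IsZero⊎HasDegree : ∀ f → IsZero f ⊎ ∃ (HasDegree f)
  IsZero⊎HasDegree [] = inj₁ λ n → refl
  IsZero⊎HasDegree (a ∷ f) with IsZero⊎HasDegree f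
  ... | inj₂ (d , fd≉0 , f≤d) = inj₂ (suc d , fd≉0 , λ { zero () ; (suc n) (s≤s d<n) → f≤d n d<n })
  ... | inj₁ f≈0 with a ≟0
  ...   | yes a≈0 = inj₁ λ { zero → a≈0 ; (suc n) → f≈0 n }
  ...   | no a≉0  = inj₂ (zero , a≉0 , λ { zero () ; (suc n) _ → f≈0 n })

  nonzero-coeff-≤ : ∀ f {m d} → ¬ (coeff f m ≈ 0#) → DegreeAtMost f d → m ℕ.≤ d
  nonzero-coeff-≤ f {m} {d} fm≉0 f≤d with m ℕ.≤? d
  ... | yes m≤d = m≤d
  ... | no m≰d  = ⊥-elim (fm≉0 (f≤d m (ℕₚ.≰⇒> m≰d)))

  hasDegree-unique : ∀ f {d e} → HasDegree f d → HasDegree f e → d ≡.≡ e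
  hasDegree-unique f (fd≉0 , f≤d) (fe≉0 , f≤e) =
    ℕₚ.≤-antisym (nonzero-coeff-≤ f fd≉0 f≤e) (nonzero-coeff-≤ f fe≉0 f≤d)

  *ₚ-monic-hasDegree : ∀ k g {e d} → HasDegree k e → MonicOfDegree g d →
    HasDegree (k *ₚ g) (e ℕ.+ d) × coeff (k *ₚ g) (e ℕ.+ d) ≈ coeff k e
  *ₚ-monic-hasDegree k g {e} {d} (ke≉0 , k≤e) (gd≈1 , g≤d) =
    ((λ top≈0 → ke≉0 (trans (sym top≈k) top≈0)) , *ₚ-degreeAtMost k g e d k≤e g≤d) , top≈k
    where
    top≈k : coeff (k *ₚ g) (e ℕ.+ d) ≈ coeff k e
    top≈k = trans (coeff-*ₚ-top k g e d k≤e g≤d) (trans (*-congˡ gd≈1) (*-identityʳ _))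

  hasDegree-resp-≈ₚ : ∀ f g {d} → f ≈ₚ g → HasDegree g d → HasDegree f d
  hasDegree-resp-≈ₚ f g f≈g (gd≉0 , g≤d) = (λ fd≈0 → gd≉0 (trans (sym (f≈g _)) fd≈0))
                                      , λ n d<n → trans (f≈g n) (g≤d n d<n)

  cofactor-hasDegree : ∀ f k g {e d} → f ≈ₚ k *ₚ g → HasDegree f e → MonicOfDegree g d →
    ∃[ e′ ] (HasDegree k e′ × e′ ℕ.+ d ≡.≡ e × coeff k e′ ≈ coeff f e)
  cofactor-hasDegree f k g {e} {d} f≈kg f-deg@(fe≉0 , _) g-monic with IsZero⊎HasDegree k
  ... | inj₁ k≈0 = ⊥-elim (fe≉0 (trans (f≈kg e) (IsZero-*ₚ k g k≈0 e)))
  ... | inj₂ (e′ , k-deg) with *ₚ-monic-hasDegree k g k-deg g-monic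
  ...   | kg-deg , top≈k with hasDegree-unique f (hasDegree-resp-≈ₚ f (k *ₚ g) f≈kg kg-deg) f-deg
  ...     | ≡.refl = e′ , k-deg , ≡.refl , trans (sym top≈k) (sym (f≈kg _))

  monic-cofactor : ∀ f k g {dF d} → f ≈ₚ k *ₚ g → MonicOfDegree f dF → MonicOfDegree g d →
    ∃[ e ] (MonicOfDegree k e × e ℕ.+ d ≡.≡ dF)
  monic-cofactor f k g f≈kg f-monic@(fd≈1 , _) g-monic
    with cofactor-hasDegree f k g f≈kg (monic⇒hasDegree f f-monic) g-monic
  ... | e , (_ , k≤e) , e+d≡dF , ke≈fdF = e , (trans ke≈fdF fd≈1 , k≤e) , e+d≡dF

  monic-∣ₚ-degree-≤ : ∀ g f {d e} → MonicOfDegree g d → g ∣ₚ f → HasDegree f e → d ℕ.≤ e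
  monic-∣ₚ-degree-≤ g f {d} g-monic (k , f≈kg) f-deg
    with cofactor-hasDegree f k g f≈kg f-deg g-monic
  ... | e′ , _ , e′+d≡e , _ = ℕₚ.≤-trans (ℕₚ.m≤n+m d e′) (ℕₚ.≤-reflexive e′+d≡e)

  monic-degree-0-*ₚ : ∀ h g → MonicOfDegree h 0 → h *ₚ g ≈ₚ g
  monic-degree-0-*ₚ h g (h0≈1 , h≤0) n =
    trans (coeff-*ₚ-constant h g h≤0 n) (trans (*-congʳ h0≈1) (*-identityˡ _))

  oneₚ-monic : MonicOfDegree oneₚ 0
  oneₚ-monic = refl , λ { zero () ; (suc n) _ → refl }

  ≈ₚ⇒∣ₚ : ∀ f g → g ≈ₚ f → f ∣ₚ g
  ≈ₚ⇒∣ₚ f g g≈f = oneₚ , λ n → trans (g≈f n) (sym (monic-degree-0-*ₚ oneₚ f oneₚ-monic n))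

  ∣ₚ-·ₚ-cancel : ∀ a g f → ¬ (a ≈ 0#) → g ∣ₚ (a ·ₚ f) → g ∣ₚ f
  ∣ₚ-·ₚ-cancel a g f a≉0 (k , af≈kg) with inverse a a≉0
  ... | b , ab≈1 = b ·ₚ k , λ n → begin
    coeff f n                  ≈⟨ sym (*-identityˡ _) ⟩
    1# * coeff f n             ≈⟨ *-congʳ (sym (trans (*-comm b a) ab≈1)) ⟩
    b * a * coeff f n          ≈⟨ *-assoc b a _ ⟩
    b * (a * coeff f n)        ≈⟨ *-congˡ (sym (coeff-·ₚ a f n)) ⟩
    b * coeff (a ·ₚ f) n       ≈⟨ *-congˡ (af≈kg n) ⟩
    b * coeff (k *ₚ g) n       ≈⟨ sym (·ₚ-*ₚ-assoc b k g n) ⟩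
    coeff ((b ·ₚ k) *ₚ g) n    ∎

  monic-divisor-of-monicPrime : ∀ P g {d} → MonicPrime P → MonicOfDegree g d → 1 ℕ.≤ d →
    g ∣ₚ P → g ≈ₚ P
  monic-divisor-of-monicPrime P g {d} ((dP , P-monic) , _ , P-prime) g-monic 1≤d (h , P≈hg)
    with monic-cofactor P h g P≈hg P-monic g-monic
  ... | e , h-monic , e+d≡dP with P-prime h g (≈ₚ⇒∣ₚ P (h *ₚ g) λ n → sym (P≈hg n))
  ...   | inj₁ P∣h =
    ⊥-elim (ℕₚ.<⇒≱ e<dP (monic-∣ₚ-degree-≤ P h P-monic P∣h (monic⇒hasDegree h h-monic)))
    where
    e<dP : e ℕ.< dP
    e<dP = ℕₚ.<-≤-trans (ℕₚ.m<m+n e 1≤d) (ℕₚ.≤-reflexive e+d≡dP)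
  ...   | inj₂ P∣g = λ n → sym (trans (P≈hg n) (monic-degree-0-*ₚ h g h-monic₀ n))
    where
    e+d≤0+d : e ℕ.+ d ℕ.≤ 0 ℕ.+ d
    e+d≤0+d = ℕₚ.≤-trans (ℕₚ.≤-reflexive e+d≡dP)
                         (monic-∣ₚ-degree-≤ P g P-monic P∣g (monic⇒hasDegree g g-monic))
    h-monic₀ : MonicOfDegree h 0
    h-monic₀ = ≡.subst (MonicOfDegree h) (ℕₚ.n≤0⇒n≡0 (ℕₚ.+-cancelʳ-≤ d e 0 e+d≤0+d)) h-monic

corollary4p5 : {c ℓ : Level} (F : FiniteField c ℓ) → let open Poly F in
    (P : Pol) → MonicPrime P → (α : Carrier) → ¬ (α ≈ 0#) →
    (Q : Pol) → MonicPrime Q → Q ∣ₚ (α ·ₚ C[ P ]1) →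
    (℘ : Pol) → IsCarlitzAnnihilator Q ℘ → ℘ ≈ₚ P
corollary4p5 F P P-prime@((dP , P-monic) , _) α α≉0 Q _ Q∣αC[P]
             ℘ ((d , ℘-monic) , (m , 1≤m , ℘m≉0) , _ , annihilates) =
  monic-divisor-of-monicPrime P ℘ P-prime ℘-monic 1≤d ℘∣P
  where
  open Poly F hiding (zero)
  open PolynomialDegree F

  Q∣C[P] : Q ∣ₚ C[ P ]1
  Q∣C[P] = ∣ₚ-·ₚ-cancel α Q C[ P ]1 α≉0 Q∣αC[P]

  P≉0 : ¬ IsZero P
  P≉0 P≈0 = proj₁ (monic⇒hasDegree P P-monic) (P≈0 dP)

  ℘∣P : ℘ ∣ₚ P
  ℘∣P = proj₂ (annihilates P P≉0) Q∣C[P]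

  1≤d : 1 ℕ.≤ d
  1≤d = ℕₚ.≤-trans 1≤m (nonzero-coeff-≤ ℘ ℘m≉0 (proj₂ ℘-monic))
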